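{- Let $k$ be a positive integer and let $m$ be an integer with $1\leq m<k$. If two integers $p_k,p_m$ satisfy $p_k>0$ and $p_m\geq p_k+\left\lfloor \frac{k}{m}\right\rfloor-1$, then there exists a connected graph $G$ such that $\psi_k(G)=p_k$ and $\psi_m(G)=p_m$.
   Context: All graphs are finite, simple and nonempty. For a graph $G=(V,E)$ and a positive integer $k$, a $k$-path vertex cover ($k$-PVC) of $G$ is a set $S\subseteq V$ such that every path on $k$ vertices in $G$ contains at least one vertex of $S$. $\psi_k(G)$ denotes the minimum cardinality of a $k$-PVC of $G$ (defined for $1\leq k\leq |V|$). -}

module Defs where

open import Data.Nat using (ℕ; suc; _≤_)
open import Data.Bool using (Bool; true; false)
open import Data.Fin using (Fin)
open import Data.Fin.Subset using (Subset; _∈_; ∣_∣)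
open import Data.Product using (Σ; ∃; _×_; _,_)
open import Relation.Binary.PropositionalEquality using (_≡_)
open import Function.Definitions using (Injective)

record Graph : Set where
  field
    n     : ℕ
    adj   : Fin n → Fin n → Bool
    sym   : ∀ u v → adj u v ≡ adj v u
    irrefl : ∀ v → adj v v ≡ false

open Graph public

Adj : (G : Graph) → Fin (n G) → Fin (n G) → Set
Adj G u v = adj G u v ≡ true

Nonempty : Graph → Set
Nonempty G = 1 ≤ n G

record Path (G : Graph) (k : ℕ) : Set where
  field
    vtx  : Fin k → Fin (n G)
    inj  : Injective _≡_ _≡_ vtx
    step : ∀ (i : Fin k) (j : Fin k) → Data.Fin.toℕ j ≡ suc (Data.Fin.toℕ i) → Adj G (vtx i) (vtx j)

open Path public

Connected : Graph → Set
Connected G = ∀ (u v : Fin (n G)) →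
  Σ ℕ λ k → Σ (Path G (suc k)) λ P →
    (vtx P Data.Fin.zero ≡ u) × (vtx P (Data.Fin.fromℕ k) ≡ v)

IsPVC : (G : Graph) → ℕ → Subset (n G) → Set
IsPVC G k S = ∀ (P : Path G k) → ∃ λ (i : Fin k) → vtx P i ∈ S

-- ψ_k(G) = p  (ψ_k is defined only for 1 ≤ k ≤ |V|):
-- there is a k-PVC of size p and every k-PVC has size at least p.
ψ≡ : (G : Graph) → ℕ → ℕ → Set
ψ≡ G k p = (1 ≤ k) × (k ≤ n G)
  × (Σ (Subset (n G)) λ S → IsPVC G k S × ∣ S ∣ ≡ p)
  × (∀ (S : Subset (n G)) → IsPVC G k S → p ≤ ∣ S ∣)

-- Write k = r + q m (r < m), pk = a + 1 and pm = a + q + e with e ≥ 0.  The graph has a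
-- spine path on k vertices, a legs (paths on m vertices) whose roots form a clique joined to
-- the whole spine, and e pendant paths on m vertices attached to spine vertex r.
--  * Upper bounds: deleting the roots and spine r (for k), resp. the roots of legs and pendant
--    paths and the q block starts r + i m (for m), leaves components with fewer than k
--    (resp. m) vertices (pvc-criterion).
--  * ψ_m ≥ a + q + e: legs, spine blocks and pendant paths are disjoint m-paths (packing).
--  * ψ_k ≥ a + 1: if a k-PVC S had at most as many spine vertices as roots outside S, swapping
--    them would turn the spine into a k-path avoiding S.
module Submission where

open import Defs
open import Data.Nat using (ℕ; NonZero; _+_; _<_; _≤_)
open import Data.Nat.DivMod using (_/_)
open import Data.Product using (Σ; _×_)

open import Data.Nat as ℕ using (zero; suc; >-nonZero⁻¹; _*_; _∸_; _≡ᵇ_; z≤n; s≤s; s≤s⁻¹; _<?_)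
open import Data.Nat.Properties
open import Data.Nat.DivMod using (_%_; m≡m%n+[m/n]*n; m%n<n; [m+kn]%n≡m%n; m<n⇒m%n≡m; n%n≡0)
open import Data.Bool using (Bool; true; false; _∧_; _∨_; if_then_else_)
open import Data.Bool.Properties using (∨-comm; ¬-not)
open import Data.Fin as Fin using (Fin; toℕ; fromℕ; fromℕ<; inject≤; splitAt; join; _↑ˡ_; _↑ʳ_; remQuot; combine)
open import Data.Fin.Properties using (toℕ-injective; toℕ<n; toℕ-fromℕ; toℕ-fromℕ<; fromℕ<-toℕ; toℕ-inject≤; inject≤-injective; injective⇒≤; any?; join-splitAt; splitAt-↑ˡ; splitAt-↑ʳ; splitAt⁻¹-↑ˡ; splitAt⁻¹-↑ʳ; remQuot-combine; combine-remQuot) renaming (suc-injective to Fin-suc-injective)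
open import Data.Fin.Subset using (Subset; _∈_; _∉_; ∣_∣; ∁; inside; outside)
open import Data.Fin.Subset.Properties using (_∈?_; ∣p∣≤n; ∣∁p∣≡n∸∣p∣; x∈∁p⇒x∉p)
open import Data.Vec using (_∷_; here; there; lookup; tabulate)
open import Data.Vec.Properties using (lookup∘tabulate; lookup⇒[]=; []=⇒lookup)
open import Data.List using (List; length; map; allFin; _++_; [_])
open import Data.List.Properties using (length-map; length-++; length-tabulate)
open import Data.List.Membership.Propositional using () renaming (_∈_ to _∈ₗ_)
open import Data.List.Membership.Propositional.Properties using (∈-map⁺; ∈-++⁺ˡ; ∈-++⁺ʳ; ∈-allFin)
open import Data.List.Relation.Unary.Any as Any using (index)
open import Data.List.Relation.Unary.Any.Properties using (lookup-index)
open import Data.Product using (∃; _,_; proj₁; proj₂; uncurry)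
open import Data.Sum as Sum using (_⊎_; inj₁; inj₂; [_,_]′)
open import Data.Sum.Properties using (inj₂-injective)
open import Data.Empty using (⊥; ⊥-elim)
open import Function using (_∘_)
open import Function.Definitions using (Injective)
open import Relation.Nullary using (¬_; Dec; yes; no; contradiction)
open import Relation.Binary.Definitions using (tri<; tri≈; tri>)
open import Relation.Nullary.Decidable using (isYes)
open import Relation.Binary.Construct.Closure.ReflexiveTransitive using (Star; ε; _◅_; _◅◅_; gmap; fold; reverse)
open import Relation.Binary.PropositionalEquality as ≡ using (_≡_; _≢_; refl; cong; subst)

-- Enumerating the elements of a subset of Fin n

rank : ∀ {n} (S : Subset n) {x : Fin n} → x ∈ S → Fin ∣ S ∣
rank (inside ∷ S) here = Fin.zero
rank (inside ∷ S) (there x∈S) = Fin.suc (rank S x∈S)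
rank (outside ∷ S) (there x∈S) = rank S x∈S

rank-injective : ∀ {n} (S : Subset n) {x y : Fin n} (x∈S : x ∈ S) (y∈S : y ∈ S) →
  rank S x∈S ≡ rank S y∈S → x ≡ y
rank-injective (inside ∷ S) here here _ = refl
rank-injective (inside ∷ S) (there x∈S) (there y∈S) eq =
  cong Fin.suc (rank-injective S x∈S y∈S (Fin-suc-injective eq))
rank-injective (outside ∷ S) (there x∈S) (there y∈S) eq = cong Fin.suc (rank-injective S x∈S y∈S eq)

enum : ∀ {n} (S : Subset n) → Fin ∣ S ∣ → Fin n
enum (inside ∷ S) Fin.zero = Fin.zero
enum (inside ∷ S) (Fin.suc i) = Fin.suc (enum S i)
enum (outside ∷ S) i = Fin.suc (enum S i)

enum∈ : ∀ {n} (S : Subset n) (i : Fin ∣ S ∣) → enum S i ∈ S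
enum∈ (inside ∷ S) Fin.zero = here
enum∈ (inside ∷ S) (Fin.suc i) = there (enum∈ S i)
enum∈ (outside ∷ S) i = there (enum∈ S i)

enum-injective : ∀ {n} (S : Subset n) → Injective _≡_ _≡_ (enum S)
enum-injective (inside ∷ S) {Fin.zero} {Fin.zero} _ = refl
enum-injective (inside ∷ S) {Fin.suc i} {Fin.suc j} eq =
  cong Fin.suc (enum-injective S (Fin-suc-injective eq))
enum-injective (outside ∷ S) eq = enum-injective S (Fin-suc-injective eq)

injection⇒≤ : ∀ {n D} (S : Subset n) (f : Fin D → Fin n) →
  Injective _≡_ _≡_ f → (∀ d → f d ∈ S) → D ≤ ∣ S ∣
injection⇒≤ S f f-inj f∈S =
  injective⇒≤ (λ eq → f-inj (rank-injective S (f∈S _) (f∈S _) eq))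

splitAt-injective : ∀ p q {d d′ : Fin (p + q)} → splitAt p d ≡ splitAt p d′ → d ≡ d′
splitAt-injective p q {d} {d′} e =
  ≡.trans (≡.sym (join-splitAt p q d)) (≡.trans (cong (join p q) e) (join-splitAt p q d′))

disjoint-injections⇒≤ : ∀ {n p q} (S : Subset n) (f : Fin p → Fin n) (g : Fin q → Fin n) →
  Injective _≡_ _≡_ f → Injective _≡_ _≡_ g → (∀ i j → f i ≢ g j) →
  (∀ i → f i ∈ S) → (∀ j → g j ∈ S) → p + q ≤ ∣ S ∣
disjoint-injections⇒≤ {p = p} {q} S f g f-inj g-inj f≢g f∈S g∈S =
  injection⇒≤ S h h-injective (λ d → h∈S (splitAt p d))
  where
  h′ : Fin p ⊎ Fin q → Fin _
  h′ = [ f , g ]′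
  h : Fin (p + q) → Fin _
  h = h′ ∘ splitAt p
  h∈S : ∀ s → h′ s ∈ S
  h∈S (inj₁ i) = f∈S i
  h∈S (inj₂ j) = g∈S j
  h′-injective : ∀ s s′ → h′ s ≡ h′ s′ → s ≡ s′
  h′-injective (inj₁ i) (inj₁ i′) eq = cong inj₁ (f-inj eq)
  h′-injective (inj₂ j) (inj₂ j′) eq = cong inj₂ (g-inj eq)
  h′-injective (inj₁ i) (inj₂ j) eq = contradiction eq (f≢g i j)
  h′-injective (inj₂ j) (inj₁ i) eq = contradiction (≡.sym eq) (f≢g i j)
  h-injective : Injective _≡_ _≡_ h
  h-injective eq = splitAt-injective p q (h′-injective _ _ eq)

covered⇒≤ : ∀ {n} (S : Subset n) (L : List (Fin n)) → (∀ {x} → x ∈ S → x ∈ₗ L) → ∣ S ∣ ≤ length L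
covered⇒≤ S L cover = injective⇒≤ position-injective
  where
  position : Fin ∣ S ∣ → Fin (length L)
  position i = index (cover (enum∈ S i))
  position-injective : Injective _≡_ _≡_ position
  position-injective {i} {j} eq = enum-injective S
    (≡.trans (lookup-index (cover (enum∈ S i)))
      (≡.trans (cong (Data.List.lookup L) eq) (≡.sym (lookup-index (cover (enum∈ S j))))))

length-map-allFin : ∀ {A : Set} {n} (f : Fin n → A) → length (map f (allFin n)) ≡ n
length-map-allFin {n = n} f = ≡.trans (length-map f (allFin n)) (length-tabulate (λ i → i))

tabulate-∈⁺ : ∀ {n} (χ : Fin n → Bool) {x} → χ x ≡ true → x ∈ tabulate χ
tabulate-∈⁺ χ {x} χx = lookup⇒[]= x (tabulate χ) (≡.trans (lookup∘tabulate χ x) χx)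

tabulate-∈⁻ : ∀ {n} (χ : Fin n → Bool) {x} → x ∈ tabulate χ → χ x ≡ true
tabulate-∈⁻ χ {x} x∈ = ≡.trans (≡.sym (lookup∘tabulate χ x)) ([]=⇒lookup x∈)

preimage : ∀ {m n} → (Fin m → Fin n) → Subset n → Subset m
preimage f S = tabulate (λ i → lookup S (f i))

∈-preimage⁺ : ∀ {m n} (f : Fin m → Fin n) (S : Subset n) {i} → f i ∈ S → i ∈ preimage f S
∈-preimage⁺ f S fi∈S = tabulate-∈⁺ (λ i → lookup S (f i)) ([]=⇒lookup fi∈S)

∈-preimage⁻ : ∀ {m n} (f : Fin m → Fin n) (S : Subset n) {i} → i ∈ preimage f S → f i ∈ S
∈-preimage⁻ f S {i} i∈ = lookup⇒[]= (f i) S (tabulate-∈⁻ (λ i → lookup S (f i)) i∈)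

-- Arithmetic of quotient and remainder

div-unique : ∀ {M} .{{_ : NonZero M}} {x x′ i i′} → x < M → x′ < M →
  x + i * M ≡ x′ + i′ * M → x ≡ x′ × i ≡ i′
div-unique {M} {x} {x′} {i} {i′} x<M x′<M eq =
  x≡x′ , *-cancelʳ-≡ i i′ M (+-cancelˡ-≡ x _ _ (≡.trans eq (cong (_+ i′ * M) (≡.sym x≡x′))))
  where
  open ≡.≡-Reasoning
  x≡x′ : x ≡ x′
  x≡x′ = begin
    x                ≡⟨ m<n⇒m%n≡m x<M ⟨
    x % M            ≡⟨ [m+kn]%n≡m%n x i M ⟨
    (x + i * M) % M  ≡⟨ cong (_% M) eq ⟩
    (x′ + i′ * M) % M ≡⟨ [m+kn]%n≡m%n x′ i′ M ⟩
    x′ % M           ≡⟨ m<n⇒m%n≡m x′<M ⟩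
    x′               ∎

div-mod-injective : ∀ {M} .{{_ : NonZero M}} {d d′} → d / M ≡ d′ / M → d % M ≡ d′ % M → d ≡ d′
div-mod-injective {M} {d} {d′} q≡ r≡ =
  ≡.trans (m≡m%n+[m/n]*n d M) (≡.trans (≡.cong₂ (λ x y → x + y * M) r≡ q≡) (≡.sym (m≡m%n+[m/n]*n d′ M)))

/-suc : ∀ {M} .{{_ : NonZero M}} d → suc d % M ≢ 0 → suc d / M ≡ d / M
/-suc {M} d suc-d%M≢0 with suc (d % M) <? M
... | yes d%M+1<M = proj₂ (div-unique (m%n<n (suc d) M) d%M+1<M
       (≡.trans (≡.sym (m≡m%n+[m/n]*n (suc d) M)) (cong suc (m≡m%n+[m/n]*n d M))))
... | no d%M+1≮M = contradiction
       (proj₁ (div-unique {i = suc d / M} {i′ = suc (d / M)} (m%n<n (suc d) M) (>-nonZero⁻¹ M) suc-d≡))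
       suc-d%M≢0
  where
  d%M+1≡M : suc (d % M) ≡ M
  d%M+1≡M = ≤-antisym (m%n<n d M) (≮⇒≥ d%M+1≮M)
  suc-d≡ : suc d % M + suc d / M * M ≡ 0 + suc (d / M) * M
  suc-d≡ = ≡.trans (≡.sym (m≡m%n+[m/n]*n (suc d) M))
             (≡.trans (cong suc (m≡m%n+[m/n]*n d M)) (cong (_+ d / M * M) d%M+1≡M))

shift-suc : ∀ {r M} x → r ≤ M → suc x + M ∸ r ≡ suc (x + M ∸ r)
shift-suc {r} {M} x r≤M = +-∸-assoc 1 (≤-trans r≤M (m≤n+m M x))

shift-injective : ∀ {r M x y} → r ≤ M → x + M ∸ r ≡ y + M ∸ r → x ≡ y
shift-injective {r} {M} {x} {y} r≤M eq =
  +-cancelʳ-≡ M x y (∸-cancelʳ-≡ (≤-trans r≤M (m≤n+m M x)) (≤-trans r≤M (m≤n+m M y)) eq)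

shift-multiple : ∀ {r M} .{{_ : NonZero M}} x → r < M → (x + M ∸ r) % M ≡ 0 → ∃ λ i → x ≡ r + i * M
shift-multiple {r} {M} x r<M rem≡0 with (x + M ∸ r) / M in quot≡
... | zero = contradiction (≤-trans (m<n⇒0<n∸m r<M) (∸-monoˡ-≤ r (m≤n+m M x)))
               (λ 0<shift → <⇒≢ 0<shift (≡.sym shift≡))
  where
  shift≡ : x + M ∸ r ≡ 0
  shift≡ = ≡.trans (m≡m%n+[m/n]*n (x + M ∸ r) M) (≡.cong₂ (λ u v → u + v * M) rem≡0 quot≡)
... | suc i = i , +-cancelʳ-≡ M x (r + i * M) x+M≡
  where
  open ≡.≡-Reasoning
  x+M≡ : x + M ≡ r + i * M + M
  x+M≡ = begin
    x + M                ≡⟨ m∸n+n≡m (≤-trans (<⇒≤ r<M) (m≤n+m M x)) ⟨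
    (x + M ∸ r) + r      ≡⟨ cong (_+ r) (m≡m%n+[m/n]*n (x + M ∸ r) M) ⟩
    (x + M ∸ r) % M + (x + M ∸ r) / M * M + r
                         ≡⟨ cong (_+ r) (≡.cong₂ (λ u v → u + v * M) rem≡0 quot≡) ⟩
    M + i * M + r        ≡⟨ +-assoc M (i * M) r ⟩
    M + (i * M + r)      ≡⟨ +-comm M (i * M + r) ⟩
    i * M + r + M        ≡⟨ cong (_+ M) (+-comm (i * M) r) ⟩
    r + i * M + M        ∎

≡ᵇ0-true : ∀ {x} → (x ≡ᵇ 0) ≡ true → x ≡ 0
≡ᵇ0-true {zero} _ = refl
≡ᵇ0-true {suc x} ()

≡ᵇ0-false : ∀ {x} → (x ≡ᵇ 0) ≡ false → x ≢ 0
≡ᵇ0-false {zero} ()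
≡ᵇ0-false {suc x} _ ()

pred< : ∀ {x M′} → x ≢ 0 → x < suc M′ → x ∸ 1 < M′
pred< {zero} x≢0 _ = contradiction refl x≢0
pred< {suc x} _ x<M = s≤s⁻¹ x<M

-- Paths in an arbitrary graph

chain : ∀ {A : Set} {K} (R : A → A → Set) (f : Fin (suc K) → A) →
  (∀ i j → toℕ j ≡ suc (toℕ i) → R (f i) (f j)) → ∀ t → Star R (f Fin.zero) (f t)
chain {K = K} R f step t =
  subst (λ s → Star R (f Fin.zero) (f s)) (fromℕ<-toℕ t (toℕ<n t)) (upTo (toℕ t) (toℕ<n t))
  where
  upTo : ∀ i (i<K : i < suc K) → Star R (f Fin.zero) (f (fromℕ< i<K))
  upTo zero _ = ε
  upTo (suc i) i<K = upTo i (<-trans (n<1+n i) i<K) ◅◅ (step _ _ consecutive ◅ ε)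
    where
    consecutive : toℕ (fromℕ< i<K) ≡ suc (toℕ (fromℕ< (<-trans (n<1+n i) i<K)))
    consecutive = ≡.trans (toℕ-fromℕ< i<K) (cong suc (≡.sym (toℕ-fromℕ< (<-trans (n<1+n i) i<K))))

PathBetween : (G : Graph) → Fin (n G) → Fin (n G) → Set
PathBetween G u v = Σ ℕ λ K → Σ (Path G (suc K)) λ P → (vtx P Fin.zero ≡ u) × (vtx P (fromℕ K) ≡ v)

point : (G : Graph) (u : Fin (n G)) → PathBetween G u u
point G u = 0 , P , refl , refl
  where
  P : Path G 1
  P = record { vtx = λ _ → u ; inj = λ { {Fin.zero} {Fin.zero} _ → refl } ; step = λ { Fin.zero Fin.zero () } }

prefix : ∀ {G K} (P : Path G (suc K)) (i : Fin (suc K)) → Path G (suc (toℕ i))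
prefix P i = record
  { vtx = λ j → vtx P (inject≤ j (toℕ<n i))
  ; inj = λ eq → inject≤-injective _ _ _ _ (inj P eq)
  ; step = λ j j′ e → step P _ _
      (≡.trans (toℕ-inject≤ j′ _) (≡.trans e (cong suc (≡.sym (toℕ-inject≤ j _))))) }

prefix-last : ∀ {G K} (P : Path G (suc K)) (i : Fin (suc K)) → vtx (prefix P i) (fromℕ (toℕ i)) ≡ vtx P i
prefix-last P i = cong (vtx P) (toℕ-injective (≡.trans (toℕ-inject≤ _ _) (toℕ-fromℕ (toℕ i))))

module Append {G : Graph} {K : ℕ} (P : Path G (suc K)) (v : Fin (n G))
  (v∉P : ∀ i → vtx P i ≢ v) (last~v : Adj G (vtx P (fromℕ K)) v) where

  at : (j : Fin (suc (suc K))) → Dec (toℕ j < suc K) → Fin (n G)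
  at j (yes j≤K) = vtx P (fromℕ< j≤K)
  at j (no _) = v

  beyond : ∀ (j : Fin (suc (suc K))) → ¬ toℕ j < suc K → toℕ j ≡ suc K
  beyond j j≰K = ≤-antisym (s≤s⁻¹ (toℕ<n j)) (≮⇒≥ j≰K)

  at-injective : ∀ j j′ d d′ → at j d ≡ at j′ d′ → j ≡ j′
  at-injective j j′ (yes p) (yes p′) eq =
    toℕ-injective (≡.trans (≡.sym (toℕ-fromℕ< p)) (≡.trans (cong toℕ (inj P eq)) (toℕ-fromℕ< p′)))
  at-injective j j′ (yes p) (no _) eq = contradiction eq (v∉P _)
  at-injective j j′ (no _) (yes p′) eq = contradiction (≡.sym eq) (v∉P _)
  at-injective j j′ (no ¬p) (no ¬p′) _ = toℕ-injective (≡.trans (beyond j ¬p) (≡.sym (beyond j′ ¬p′)))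

  at-step : ∀ j j′ d d′ → toℕ j′ ≡ suc (toℕ j) → Adj G (at j d) (at j′ d′)
  at-step j j′ (yes p) (yes p′) e =
    step P _ _ (≡.trans (toℕ-fromℕ< p′) (≡.trans e (cong suc (≡.sym (toℕ-fromℕ< p)))))
  at-step j j′ (yes p) (no ¬p′) e = subst (λ w → Adj G w v) (cong (vtx P) j-is-last) last~v
    where
    j-is-last : fromℕ K ≡ fromℕ< p
    j-is-last = toℕ-injective (≡.trans (toℕ-fromℕ K)
      (≡.trans (suc-injective (≡.trans (≡.sym (beyond j′ ¬p′)) e)) (≡.sym (toℕ-fromℕ< p))))
  at-step j j′ (no ¬p) _ e = ⊥-elim (<-irrefl (≡.trans e (cong suc (beyond j ¬p))) (toℕ<n j′))

  path : Path G (suc (suc K))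
  path = record
    { vtx = λ j → at j (toℕ j <? suc K)
    ; inj = λ {j} {j′} → at-injective j j′ (toℕ j <? suc K) (toℕ j′ <? suc K)
    ; step = λ j j′ → at-step j j′ (toℕ j <? suc K) (toℕ j′ <? suc K) }

  path-last : vtx path (fromℕ (suc K)) ≡ v
  path-last with toℕ (fromℕ (suc K)) <? suc K
  ... | yes p = ⊥-elim (<-irrefl (toℕ-fromℕ (suc K)) p)
  ... | no _ = refl

-- Extending a path by an edge: truncate if the new vertex is already on it, append otherwise.
extend : ∀ {G u w v} → PathBetween G u w → Adj G w v → PathBetween G u v
extend {G} {v = v} (K , P , start , end) w~v with any? (λ i → vtx P i Fin.≟ v)
... | yes (i , Pi≡v) = toℕ i , prefix P i , start , ≡.trans (prefix-last P i) Pi≡v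
... | no v∉P = suc K , path , start , path-last
  where
  open Append P v (λ i e → v∉P (i , e)) (subst (λ w → Adj G w v) (≡.sym end) w~v)

reachable⇒path : ∀ {G u v} → Star (Adj G) u v → PathBetween G u v
reachable⇒path {G} {u} = go (point G u)
  where
  go : ∀ {w v} → PathBetween G u w → Star (Adj G) w v → PathBetween G u v
  go P ε = P
  go P (e ◅ s) = go (extend P e) s

connected-via : (G : Graph) (h : Fin (n G)) → (∀ v → Star (Adj G) h v) → Connected G
connected-via G h reach u v = reachable⇒path (reverse adj-sym (reach u) ◅◅ reach v)
  where
  adj-sym : ∀ {x y} → Adj G x y → Adj G y x
  adj-sym {x} {y} e = ≡.trans (≡.sym (Graph.sym G x y)) e

disjoint-paths⇒≤ : ∀ {G K D} (P : Fin D → Path G K) →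
  (∀ {d d′} i j → vtx (P d) i ≡ vtx (P d′) j → d ≡ d′) →
  ∀ S → IsPVC G K S → D ≤ ∣ S ∣
disjoint-paths⇒≤ P disjoint S pvc = injection⇒≤ S hit (disjoint _ _) (λ d → proj₂ (pvc (P d)))
  where
  hit : Fin _ → Fin _
  hit d = vtx (P d) (proj₁ (pvc (P d)))

-- Graphs on a finite vertex type, given by a decidable irreflexive edge relation

module Encoded {V : Set} {N : ℕ} (enc : V → Fin N) (dec : Fin N → V)
  (dec-enc : ∀ v → dec (enc v) ≡ v) (enc-dec : ∀ x → enc (dec x) ≡ x)
  (Edge : V → V → Set) (edge? : ∀ u v → Dec (Edge u v)) (edge-irrefl : ∀ {v} → ¬ Edge v v) where

  infix 4 _~_
  _~_ : V → V → Set
  u ~ v = Edge u v ⊎ Edge v u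

  adjacent : V → V → Bool
  adjacent u v = isYes (edge? u v) ∨ isYes (edge? v u)

  adjacent-sound : ∀ u v → adjacent u v ≡ true → u ~ v
  adjacent-sound u v h with edge? u v | edge? v u
  ... | yes e | _ = inj₁ e
  ... | no _ | yes e = inj₂ e
  adjacent-sound u v () | no _ | no _

  adjacent-complete : ∀ u v → u ~ v → adjacent u v ≡ true
  adjacent-complete u v u~v with edge? u v | edge? v u
  ... | yes _ | _ = refl
  ... | no _ | yes _ = refl
  ... | no ¬e | no ¬e′ = ⊥-elim ([ ¬e , ¬e′ ]′ u~v)

  adjacent-irrefl : ∀ v → adjacent v v ≡ false
  adjacent-irrefl v with edge? v v
  ... | yes e = ⊥-elim (edge-irrefl e)
  ... | no _ = refl

  G : Graph
  G = record
    { n = N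
    ; adj = λ x y → adjacent (dec x) (dec y)
    ; sym = λ x y → ∨-comm (isYes (edge? (dec x) (dec y))) (isYes (edge? (dec y) (dec x)))
    ; irrefl = λ x → adjacent-irrefl (dec x) }

  enc-injective : Injective _≡_ _≡_ enc
  enc-injective {u} {v} eq = ≡.trans (≡.sym (dec-enc u)) (≡.trans (cong dec eq) (dec-enc v))

  dec-injective : Injective _≡_ _≡_ dec
  dec-injective {x} {y} eq = ≡.trans (≡.sym (enc-dec x)) (≡.trans (cong enc eq) (enc-dec y))

  ~⇒Adj : ∀ {u v} → u ~ v → Adj G (enc u) (enc v)
  ~⇒Adj {u} {v} u~v = ≡.subst₂ (λ x y → adjacent x y ≡ true) (≡.sym (dec-enc u)) (≡.sym (dec-enc v))
    (adjacent-complete u v u~v)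

  Adj⇒~ : ∀ {x y} → Adj G x y → dec x ~ dec y
  Adj⇒~ = adjacent-sound _ _

  liftPath : ∀ {K} (f : Fin K → V) → Injective _≡_ _≡_ f →
    (∀ i j → toℕ j ≡ suc (toℕ i) → f i ~ f j) → Path G K
  liftPath f f-inj f-step = record
    { vtx = enc ∘ f ; inj = f-inj ∘ enc-injective ; step = λ i j e → ~⇒Adj (f-step i j e) }

  connected-from : (h : V) → (∀ v → Star _~_ h v) → Connected G
  connected-from h reach = connected-via G (enc h)
    (λ x → subst (Star (Adj G) (enc h)) (enc-dec x) (gmap enc ~⇒Adj (reach (dec x))))

  marked : (V → Bool) → Subset N
  marked χ = tabulate (χ ∘ dec)

  marked-size : (χ : V → Bool) (L : List V) → (∀ {v} → χ v ≡ true → v ∈ₗ L) → ∣ marked χ ∣ ≤ length L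
  marked-size χ L cover = ≤-trans (covered⇒≤ (marked χ) (map enc L) cover′) (≤-reflexive (length-map enc L))
    where
    cover′ : ∀ {x} → x ∈ marked χ → x ∈ₗ map enc L
    cover′ {x} x∈ = subst (_∈ₗ map enc L) (enc-dec x) (∈-map⁺ enc (cover (tabulate-∈⁻ (χ ∘ dec) x∈)))

  -- Then a K-path avoiding the marked set would embed Fin K into Fin B.
  pvc-criterion : ∀ {C : Set} {B K} (χ : V → Bool) (part : V → C) (pos : V → ℕ) → B < K →
    (∀ {u v} → χ u ≡ false → χ v ≡ false → u ~ v → part u ≡ part v) →
    (∀ {v} → χ v ≡ false → pos v < B) →
    (∀ {u v} → χ u ≡ false → χ v ≡ false → part u ≡ part v → pos u ≡ pos v → u ≡ v) →
    IsPVC G K (marked χ)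
  pvc-criterion {K = zero} χ part pos () _ _ _ P
  pvc-criterion {B = B} {suc K} χ part pos B<K part-step pos-bound pos-injective P
    with any? (λ i → χ (dec (vtx P i)) Data.Bool.≟ true)
  ... | yes (i , marked-i) = i , tabulate-∈⁺ (χ ∘ dec) marked-i
  ... | no none = ⊥-elim (<⇒≱ B<K (injective⇒≤ slot-injective))
    where
    w : Fin (suc K) → V
    w i = dec (vtx P i)
    free : ∀ i → χ (w i) ≡ false
    free i = ¬-not (λ marked-i → none (i , marked-i))
    same-part : ∀ i → part (w Fin.zero) ≡ part (w i)
    same-part = fold (λ x y → part x ≡ part y) ≡.trans refl
      ∘ chain (λ x y → part x ≡ part y) w (λ i j e → part-step (free i) (free j) (Adj⇒~ (step P i j e)))
    slot : Fin (suc K) → Fin B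
    slot i = fromℕ< (pos-bound (free i))
    slot-injective : Injective _≡_ _≡_ slot
    slot-injective {i} {j} eq = inj P (dec-injective (pos-injective (free i) (free j)
      (≡.trans (≡.sym (same-part i)) (same-part j))
      (≡.trans (≡.sym (toℕ-fromℕ< _)) (≡.trans (cong toℕ eq) (toℕ-fromℕ< _)))))

module Construction (a e q r m′ k′ : ℕ) (k≡ : suc k′ ≡ r + q * suc m′)
  (r<m : r < suc m′) (m<k : suc m′ < suc k′) where

  k m : ℕ
  k = suc k′
  m = suc m′

  r<k : r < k
  r<k = <-trans r<m m<k

  data V : Set where
    leg   : Fin a → Fin m → V
    spine : Fin k → V
    pend  : Fin e → Fin m → V

  root : Fin a → V
  root i = leg i Fin.zero

  data Edge : V → V → Set where
    leg-step   : ∀ {i x y} → toℕ y ≡ suc (toℕ x) → Edge (leg i x) (leg i y)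
    root-root  : ∀ {i j} → toℕ i < toℕ j → Edge (root i) (root j)
    root-spine : ∀ {i t} → Edge (root i) (spine t)
    spine-step : ∀ {t t′} → toℕ t′ ≡ suc (toℕ t) → Edge (spine t) (spine t′)
    pend-step  : ∀ {j x y} → toℕ y ≡ suc (toℕ x) → Edge (pend j x) (pend j y)
    hub-pend   : ∀ {t j} → toℕ t ≡ r → Edge (spine t) (pend j Fin.zero)

  edge-irrefl : ∀ {v} → ¬ Edge v v
  edge-irrefl (leg-step p) = 1+n≢n (≡.sym p)
  edge-irrefl (root-root p) = <-irrefl refl p
  edge-irrefl (spine-step p) = 1+n≢n (≡.sym p)
  edge-irrefl (pend-step p) = 1+n≢n (≡.sym p)

  edge? : ∀ u v → Dec (Edge u v)
  edge? (leg i x) (leg j y) with i Fin.≟ j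
  ... | yes refl with toℕ y ℕ.≟ suc (toℕ x)
  ...   | yes p = yes (leg-step p)
  ...   | no ¬p = no λ { (leg-step p) → ¬p p ; (root-root p) → <-irrefl refl p }
  edge? (leg i Fin.zero) (leg j Fin.zero) | no i≢j with toℕ i <? toℕ j
  ... | yes p = yes (root-root p)
  ... | no ¬p = no λ { (leg-step _) → i≢j refl ; (root-root p) → ¬p p }
  edge? (leg i Fin.zero) (leg j (Fin.suc y)) | no i≢j = no λ { (leg-step _) → i≢j refl }
  edge? (leg i (Fin.suc x)) (leg j y) | no i≢j = no λ { (leg-step _) → i≢j refl }
  edge? (leg i Fin.zero) (spine t) = yes root-spine
  edge? (leg i (Fin.suc x)) (spine t) = no λ ()
  edge? (leg i x) (pend j y) = no λ ()
  edge? (spine t) (leg i x) = no λ ()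
  edge? (spine t) (spine t′) with toℕ t′ ℕ.≟ suc (toℕ t)
  ... | yes p = yes (spine-step p)
  ... | no ¬p = no λ { (spine-step p) → ¬p p }
  edge? (spine t) (pend j Fin.zero) with toℕ t ℕ.≟ r
  ... | yes p = yes (hub-pend p)
  ... | no ¬p = no λ { (hub-pend p) → ¬p p }
  edge? (spine t) (pend j (Fin.suc y)) = no λ ()
  edge? (pend j x) (leg i y) = no λ ()
  edge? (pend j x) (spine t) = no λ ()
  edge? (pend j x) (pend j′ y) with j Fin.≟ j′
  ... | yes refl with toℕ y ℕ.≟ suc (toℕ x)
  ...   | yes p = yes (pend-step p)
  ...   | no ¬p = no λ { (pend-step p) → ¬p p }
  edge? (pend j x) (pend j′ y) | no j≢j′ = no λ { (pend-step _) → j≢j′ refl }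

  N : ℕ
  N = a * m + (k + e * m)

  enc : V → Fin N
  enc (leg i x) = combine i x ↑ˡ (k + e * m)
  enc (spine t) = (a * m) ↑ʳ (t ↑ˡ (e * m))
  enc (pend j x) = (a * m) ↑ʳ (k ↑ʳ combine j x)

  dec₂ : Fin (k + e * m) → V
  dec₂ z = [ spine , (λ w → uncurry pend (remQuot m w)) ]′ (splitAt k z)

  dec : Fin N → V
  dec x = [ (λ y → uncurry leg (remQuot m y)) , dec₂ ]′ (splitAt (a * m) x)

  dec-enc : ∀ v → dec (enc v) ≡ v
  dec-enc (leg i x) rewrite splitAt-↑ˡ (a * m) (combine i x) (k + e * m) =
    cong (uncurry leg) (remQuot-combine {a} {m} i x)
  dec-enc (spine t) rewrite splitAt-↑ʳ (a * m) (k + e * m) (t ↑ˡ (e * m)) | splitAt-↑ˡ k t (e * m) = refl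
  dec-enc (pend j x) rewrite splitAt-↑ʳ (a * m) (k + e * m) (k ↑ʳ combine j x)
                           | splitAt-↑ʳ k (e * m) (combine j x) =
    cong (uncurry pend) (remQuot-combine {e} {m} j x)

  enc-dec₂ : ∀ z → (a * m) ↑ʳ z ≡ enc (dec₂ z)
  enc-dec₂ z with splitAt k z in eq
  ... | inj₁ t = cong ((a * m) ↑ʳ_) (≡.sym (splitAt⁻¹-↑ˡ eq))
  ... | inj₂ w = cong ((a * m) ↑ʳ_)
    (≡.trans (≡.sym (splitAt⁻¹-↑ʳ eq)) (cong (k ↑ʳ_) (≡.sym (combine-remQuot {e} m w))))

  enc-dec : ∀ x → enc (dec x) ≡ x
  enc-dec x with splitAt (a * m) x in eq
  ... | inj₁ y = ≡.trans (cong (_↑ˡ (k + e * m)) (combine-remQuot {a} m y)) (splitAt⁻¹-↑ˡ eq)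
  ... | inj₂ z = ≡.trans (≡.sym (enc-dec₂ z)) (splitAt⁻¹-↑ʳ eq)

  open Encoded enc dec dec-enc enc-dec Edge edge? edge-irrefl public

  k≤N : k ≤ N
  k≤N = ≤-trans (m≤m+n k (e * m)) (m≤n+m (k + e * m) (a * m))

  nonempty : Nonempty G
  nonempty = ≤-trans (s≤s z≤n) k≤N

  hub : Fin k
  hub = fromℕ< r<k

  along-spine : ∀ t → Star _~_ (spine Fin.zero) (spine t)
  along-spine = chain _~_ spine (λ _ _ e → inj₁ (spine-step e))

  along-leg : ∀ i x → Star _~_ (root i) (leg i x)
  along-leg i = chain _~_ (leg i) (λ _ _ e → inj₁ (leg-step e))

  along-pend : ∀ j x → Star _~_ (pend j Fin.zero) (pend j x)
  along-pend j = chain _~_ (pend j) (λ _ _ e → inj₁ (pend-step e))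

  reach : ∀ v → Star _~_ (spine Fin.zero) v
  reach (spine t) = along-spine t
  reach (leg i x) = inj₂ root-spine ◅ along-leg i x
  reach (pend j x) = along-spine hub ◅◅ (inj₁ (hub-pend (toℕ-fromℕ< r<k)) ◅ along-pend j x)

  connected : Connected G
  connected = connected-from (spine Fin.zero) reach

  -- Shifting spine index t to offset M t = t + M ∸ r sends the spine vertices
  -- r, r + M, r + 2M, … to the multiples of M; these are cut, and the spine splits into
  -- segments numbered by offset M t / M.  For M = k only spine r is cut, for M = m the
  -- starts of the q blocks of length m following spine r are cut.

  offset : ℕ → Fin k → ℕ
  offset M t = toℕ t + M ∸ r

  spine-cut : (M : ℕ) .{{_ : NonZero M}} → Fin k → Bool
  spine-cut M t = offset M t % M ≡ᵇ 0

  isRoot : Fin m → Bool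
  isRoot Fin.zero = true
  isRoot (Fin.suc _) = false

  -- the flag c says whether the roots of the pendant paths are cut as well
  cut : (M : ℕ) .{{_ : NonZero M}} → Bool → V → Bool
  cut M c (leg i x) = isRoot x
  cut M c (spine t) = spine-cut M t
  cut M c (pend j x) = c ∧ isRoot x

  -- what is left after cutting: the legs and pendant paths without roots, and spine segments
  data Part : Set where
    legPart  : Fin a → Part
    pendPart : Fin e → Part
    segment  : ℕ → Part

  segment-injective : ∀ {x y} → segment x ≡ segment y → x ≡ y
  segment-injective refl = refl

  part : (M : ℕ) .{{_ : NonZero M}} → V → Part
  part M (leg i x) = legPart i
  part M (spine t) = segment (offset M t / M)
  part M (pend j x) = pendPart j

  pos : (M : ℕ) .{{_ : NonZero M}} → Bool → V → ℕ
  pos M c (leg i x) = toℕ x ∸ 1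
  pos M c (spine t) = offset M t % M ∸ 1
  pos M c (pend j x) = if c then toℕ x ∸ 1 else toℕ x

  hub-cut : ∀ M .{{_ : NonZero M}} {t} → toℕ t ≡ r → spine-cut M t ≡ true
  hub-cut M {t} t≡r = ≡.trans (cong (λ d → d % M ≡ᵇ 0) offset≡M) (cong (_≡ᵇ 0) (n%n≡0 M))
    where
    offset≡M : offset M t ≡ M
    offset≡M = ≡.trans (cong (λ x → x + M ∸ r) t≡r) (m+n∸m≡n r M)

  part-edge : ∀ M .{{_ : NonZero M}} c → r ≤ M → ∀ {u v} →
    cut M c u ≡ false → cut M c v ≡ false → Edge u v → part M u ≡ part M v
  part-edge M c r≤M _ _ (leg-step _) = refl
  part-edge M c r≤M () _ (root-root _)
  part-edge M c r≤M () _ root-spine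
  part-edge M c r≤M {spine t} {spine t′} _ t′-uncut (spine-step t′≡) =
    cong segment (≡.sym (≡.trans (cong (_/ M) offset-step) (/-suc (offset M t) (subst (λ d → d % M ≢ 0) offset-step (≡ᵇ0-false t′-uncut)))))
    where
    offset-step : offset M t′ ≡ suc (offset M t)
    offset-step = ≡.trans (cong (λ x → x + M ∸ r) t′≡) (shift-suc (toℕ t) r≤M)
  part-edge M c r≤M _ _ (pend-step _) = refl
  part-edge M c r≤M t-uncut _ (hub-pend t≡r) = contradiction (≡.trans (≡.sym (hub-cut M t≡r)) t-uncut) λ ()

  part-step : ∀ M .{{_ : NonZero M}} c → r ≤ M → ∀ {u v} →
    cut M c u ≡ false → cut M c v ≡ false → u ~ v → part M u ≡ part M v
  part-step M c r≤M u-uncut v-uncut (inj₁ uv) = part-edge M c r≤M u-uncut v-uncut uv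
  part-step M c r≤M u-uncut v-uncut (inj₂ vu) = ≡.sym (part-edge M c r≤M v-uncut u-uncut vu)

  spine-pos-injective : ∀ M .{{_ : NonZero M}} → r ≤ M → ∀ {t t′} →
    spine-cut M t ≡ false → spine-cut M t′ ≡ false →
    offset M t / M ≡ offset M t′ / M → offset M t % M ∸ 1 ≡ offset M t′ % M ∸ 1 → t ≡ t′
  spine-pos-injective M r≤M t-uncut t′-uncut quot≡ pos≡ =
    toℕ-injective (shift-injective r≤M (div-mod-injective quot≡
      (∸-cancelʳ-≡ (n≢0⇒n>0 (≡ᵇ0-false t-uncut)) (n≢0⇒n>0 (≡ᵇ0-false t′-uncut)) pos≡)))

  pos-injective : ∀ M .{{_ : NonZero M}} c → r ≤ M → ∀ {u v} →
    cut M c u ≡ false → cut M c v ≡ false → part M u ≡ part M v → pos M c u ≡ pos M c v → u ≡ v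
  pos-injective M c r≤M {leg i (Fin.suc x)} {leg .i (Fin.suc y)} _ _ refl eq = cong (leg i ∘ Fin.suc) (toℕ-injective eq)
  pos-injective M c r≤M {leg i Fin.zero} () _ _ _
  pos-injective M c r≤M {leg i (Fin.suc x)} {leg j Fin.zero} _ () _ _
  pos-injective M c r≤M {spine t} {spine t′} t-uncut t′-uncut part≡ pos≡ =
    cong spine (spine-pos-injective M r≤M t-uncut t′-uncut (segment-injective part≡) pos≡)
  pos-injective M true r≤M {pend j (Fin.suc x)} {pend .j (Fin.suc y)} _ _ refl eq = cong (pend j ∘ Fin.suc) (toℕ-injective eq)
  pos-injective M true r≤M {pend j Fin.zero} () _ _ _
  pos-injective M true r≤M {pend j (Fin.suc x)} {pend j′ Fin.zero} _ () _ _
  pos-injective M false r≤M {pend j x} {pend .j y} _ _ refl eq = cong (pend j) (toℕ-injective eq)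
  pos-injective M c r≤M {leg _ _} {spine _} _ _ () _
  pos-injective M c r≤M {leg _ _} {pend _ _} _ _ () _
  pos-injective M c r≤M {spine _} {leg _ _} _ _ () _
  pos-injective M c r≤M {spine _} {pend _ _} _ _ () _
  pos-injective M c r≤M {pend _ _} {leg _ _} _ _ () _
  pos-injective M c r≤M {pend _ _} {spine _} _ _ () _

  spine-pos-bound : ∀ M′ {t} → spine-cut (suc M′) t ≡ false → offset (suc M′) t % suc M′ ∸ 1 < M′
  spine-pos-bound M′ {t} t-uncut = pred< (≡ᵇ0-false t-uncut) (m%n<n (offset (suc M′) t) (suc M′))

  -- Upper bound for k: the roots together with spine r form a k-path vertex cover.
  Sk : Subset N
  Sk = marked (cut k false)

  Sk-pvc : IsPVC G k Sk
  Sk-pvc = pvc-criterion (cut k false) (part k) (pos k false) (n<1+n k′)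
    (part-step k false (<⇒≤ r<k)) (λ {v} → bound {v}) (pos-injective k false (<⇒≤ r<k))
    where
    bound : ∀ {v} → cut k false v ≡ false → pos k false v < k′
    bound {leg i Fin.zero} ()
    bound {leg i (Fin.suc x)} _ = <-trans (toℕ<n x) (s≤s⁻¹ m<k)
    bound {spine t} t-uncut = spine-pos-bound k′ t-uncut
    bound {pend j x} _ = <-≤-trans (toℕ<n x) (s≤s⁻¹ m<k)

  spine-cut-k : ∀ {t} → spine-cut k t ≡ true → toℕ t ≡ r
  spine-cut-k {t} t-cut with shift-multiple (toℕ t) r<k (≡ᵇ0-true t-cut)
  ... | zero , t≡ = ≡.trans t≡ (+-identityʳ r)
  ... | suc i , t≡ = contradiction (toℕ<n t)
    (≤⇒≯ (≤-trans (≤-trans (m≤m+n k (i * k)) (m≤n+m _ r)) (≤-reflexive (≡.sym t≡))))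

  roots : List V
  roots = map root (allFin a)

  root∈roots : ∀ i → root i ∈ₗ roots
  root∈roots i = ∈-map⁺ root (∈-allFin i)

  Sk-size : ∣ Sk ∣ ≤ suc a
  Sk-size = ≤-trans (marked-size (cut k false) (roots ++ [ spine hub ]) cover) (≤-reflexive length≡)
    where
    cover : ∀ {v} → cut k false v ≡ true → v ∈ₗ roots ++ [ spine hub ]
    cover {leg i Fin.zero} _ = ∈-++⁺ˡ (root∈roots i)
    cover {leg i (Fin.suc x)} ()
    cover {spine t} t-cut = ∈-++⁺ʳ roots
      (Any.here (cong spine (toℕ-injective (≡.trans (spine-cut-k t-cut) (≡.sym (toℕ-fromℕ< r<k))))))
    cover {pend j x} ()
    length≡ : length (roots ++ [ spine hub ]) ≡ suc a
    length≡ = ≡.trans (length-++ roots) (≡.trans (cong (_+ 1) (length-map-allFin root)) (+-comm a 1))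

  -- The spine consists of r vertices followed by q blocks of m vertices.
  block< : (b : Fin q) (x : Fin m) → r + toℕ b * m + toℕ x < k
  block< b x = subst (r + toℕ b * m + toℕ x <_) (≡.sym k≡) (begin-strict
    r + toℕ b * m + toℕ x    ≡⟨ +-assoc r _ _ ⟩
    r + (toℕ b * m + toℕ x)  <⟨ +-monoʳ-< r (+-monoʳ-< (toℕ b * m) (toℕ<n x)) ⟩
    r + (toℕ b * m + m)      ≡⟨ cong (r +_) (+-comm (toℕ b * m) m) ⟩
    r + suc (toℕ b) * m      ≤⟨ +-monoʳ-≤ r (*-monoˡ-≤ m (toℕ<n b)) ⟩
    r + q * m                ∎)
    where open ≤-Reasoning

  block : Fin q → Fin m → Fin k
  block b x = fromℕ< (block< b x)

  spine-cut-m : ∀ {t} → spine-cut m t ≡ true → ∃ λ b → t ≡ block b Fin.zero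
  spine-cut-m {t} t-cut with shift-multiple (toℕ t) r<m (≡ᵇ0-true t-cut)
  ... | i , t≡ = fromℕ< i<q , toℕ-injective (≡.trans t≡ (≡.sym block≡))
    where
    i<q : i < q
    i<q = *-cancelʳ-< m i q (+-cancelˡ-< r _ _ (subst (r + i * m <_) k≡ (subst (_< k) t≡ (toℕ<n t))))
    block≡ : toℕ (block (fromℕ< i<q) Fin.zero) ≡ r + i * m
    block≡ = ≡.trans (toℕ-fromℕ< _) (≡.trans (+-identityʳ _) (cong (λ b → r + b * m) (toℕ-fromℕ< i<q)))

  -- Upper bound for m: the roots of legs and pendant paths and the block starts.
  Sm : Subset N
  Sm = marked (cut m true)

  Sm-pvc : IsPVC G m Sm
  Sm-pvc = pvc-criterion (cut m true) (part m) (pos m true) (n<1+n m′)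
    (part-step m true (<⇒≤ r<m)) (λ {v} → bound {v}) (pos-injective m true (<⇒≤ r<m))
    where
    bound : ∀ {v} → cut m true v ≡ false → pos m true v < m′
    bound {leg i Fin.zero} ()
    bound {leg i (Fin.suc x)} _ = toℕ<n x
    bound {spine t} t-uncut = spine-pos-bound m′ t-uncut
    bound {pend j Fin.zero} ()
    bound {pend j (Fin.suc x)} _ = toℕ<n x

  Sm-size : ∣ Sm ∣ ≤ a + (q + e)
  Sm-size = ≤-trans (marked-size (cut m true) (roots ++ (starts ++ pendRoots)) cover) (≤-reflexive length≡)
    where
    starts pendRoots : List V
    starts = map (λ b → spine (block b Fin.zero)) (allFin q)
    pendRoots = map (λ j → pend j Fin.zero) (allFin e)
    cover : ∀ {v} → cut m true v ≡ true → v ∈ₗ roots ++ (starts ++ pendRoots)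
    cover {leg i Fin.zero} _ = ∈-++⁺ˡ (root∈roots i)
    cover {leg i (Fin.suc x)} ()
    cover {spine t} t-cut with spine-cut-m t-cut
    ... | b , refl = ∈-++⁺ʳ roots (∈-++⁺ˡ (∈-map⁺ (λ b → spine (block b Fin.zero)) (∈-allFin b)))
    cover {pend j Fin.zero} _ = ∈-++⁺ʳ roots (∈-++⁺ʳ starts (∈-map⁺ (λ j → pend j Fin.zero) (∈-allFin j)))
    cover {pend j (Fin.suc x)} ()
    length≡ : length (roots ++ (starts ++ pendRoots)) ≡ a + (q + e)
    length≡ = ≡.trans (length-++ roots) (≡.cong₂ _+_ (length-map-allFin root)
      (≡.trans (length-++ starts) (≡.cong₂ _+_ (length-map-allFin (λ b → spine (block b Fin.zero)))
        (length-map-allFin (λ j → pend j Fin.zero)))))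

  -- Lower bound for m: the legs, the blocks of the spine and the pendant paths are
  -- a + q + e vertex-disjoint m-paths.
  Strand : Set
  Strand = Fin a ⊎ (Fin q ⊎ Fin e)

  strand : Strand → Fin m → V
  strand (inj₁ i) x = leg i x
  strand (inj₂ (inj₁ b)) x = spine (block b x)
  strand (inj₂ (inj₂ j)) x = pend j x

  spine-injective : ∀ {t t′} → spine t ≡ spine t′ → t ≡ t′
  spine-injective refl = refl

  block-injective : ∀ {b b′ x y} → block b x ≡ block b′ y → b ≡ b′ × x ≡ y
  block-injective {b} {b′} {x} {y} eq =
    toℕ-injective (proj₂ quot-rem≡) , toℕ-injective (proj₁ quot-rem≡)
    where
    open ≡.≡-Reasoning
    index≡ : r + toℕ b * m + toℕ x ≡ r + toℕ b′ * m + toℕ y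
    index≡ = ≡.trans (≡.sym (toℕ-fromℕ< (block< b x))) (≡.trans (cong toℕ eq) (toℕ-fromℕ< (block< b′ y)))
    quot-rem≡ : toℕ x ≡ toℕ y × toℕ b ≡ toℕ b′
    quot-rem≡ = div-unique (toℕ<n x) (toℕ<n y) (+-cancelˡ-≡ r _ _ (begin
      r + (toℕ x + toℕ b * m)   ≡⟨ cong (r +_) (+-comm (toℕ x) _) ⟩
      r + (toℕ b * m + toℕ x)   ≡⟨ +-assoc r _ _ ⟨
      r + toℕ b * m + toℕ x     ≡⟨ index≡ ⟩
      r + toℕ b′ * m + toℕ y    ≡⟨ +-assoc r _ _ ⟩
      r + (toℕ b′ * m + toℕ y)  ≡⟨ cong (r +_) (+-comm _ (toℕ y)) ⟩
      r + (toℕ y + toℕ b′ * m)  ∎))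

  strand-injective : ∀ {s s′ x y} → strand s x ≡ strand s′ y → s ≡ s′ × x ≡ y
  strand-injective {inj₁ i} {inj₁ .i} refl = refl , refl
  strand-injective {inj₂ (inj₁ b)} {inj₂ (inj₁ b′)} {x} {y} eq
    with block-injective {b} {b′} {x} {y} (spine-injective eq)
  ... | refl , x≡y = refl , x≡y
  strand-injective {inj₂ (inj₂ j)} {inj₂ (inj₂ .j)} refl = refl , refl
  strand-injective {inj₁ _} {inj₂ (inj₁ _)} ()
  strand-injective {inj₁ _} {inj₂ (inj₂ _)} ()
  strand-injective {inj₂ (inj₁ _)} {inj₁ _} ()
  strand-injective {inj₂ (inj₁ _)} {inj₂ (inj₂ _)} ()
  strand-injective {inj₂ (inj₂ _)} {inj₁ _} ()
  strand-injective {inj₂ (inj₂ _)} {inj₂ (inj₁ _)} ()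

  strand-step : ∀ s x y → toℕ y ≡ suc (toℕ x) → strand s x ~ strand s y
  strand-step (inj₁ i) x y e = inj₁ (leg-step e)
  strand-step (inj₂ (inj₁ b)) x y e = inj₁ (spine-step (begin
    toℕ (block b y)               ≡⟨ toℕ-fromℕ< (block< b y) ⟩
    r + toℕ b * m + toℕ y         ≡⟨ cong (r + toℕ b * m +_) e ⟩
    r + toℕ b * m + suc (toℕ x)   ≡⟨ +-suc _ (toℕ x) ⟩
    suc (r + toℕ b * m + toℕ x)   ≡⟨ cong suc (toℕ-fromℕ< (block< b x)) ⟨
    suc (toℕ (block b x))         ∎))
    where open ≡.≡-Reasoning
  strand-step (inj₂ (inj₂ j)) x y e = inj₁ (pend-step e)

  strandPath : Strand → Path G m
  strandPath s = liftPath (strand s) (proj₂ ∘ strand-injective) (strand-step s)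

  split3 : Fin (a + (q + e)) → Strand
  split3 = Sum.map₂ (splitAt q) ∘ splitAt a

  split3-injective : Injective _≡_ _≡_ split3
  split3-injective eq = splitAt-injective a (q + e) (map₂-injective eq)
    where
    map₂-injective : ∀ {s s′ : Fin a ⊎ Fin (q + e)} →
      Sum.map₂ (splitAt q) s ≡ Sum.map₂ (splitAt q) s′ → s ≡ s′
    map₂-injective {inj₁ _} {inj₁ _} refl = refl
    map₂-injective {inj₂ _} {inj₂ _} eq = cong inj₂ (splitAt-injective q e (inj₂-injective eq))
    map₂-injective {inj₁ _} {inj₂ _} ()
    map₂-injective {inj₂ _} {inj₁ _} ()

  lowerM : ∀ S → IsPVC G m S → a + (q + e) ≤ ∣ S ∣
  lowerM = disjoint-paths⇒≤ (strandPath ∘ split3)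
    (λ _ _ eq → split3-injective (proj₁ (strand-injective (enc-injective eq))))

  -- Let H be the spine vertices in S and F the roots outside S.
  -- If ∣ H ∣ ≤ ∣ F ∣, replacing each spine vertex in S by its own root outside S turns the
  -- spine into a k-path avoiding S (the roots form a clique joined to the whole spine).
  -- Hence ∣ F ∣ < ∣ H ∣, and S contains the a ∸ ∣ F ∣ other roots and the ∣ H ∣ spine vertices.

  root-injective : ∀ {i j} → root i ≡ root j → i ≡ j
  root-injective refl = refl

  roots-adjacent : ∀ {i j} → i ≢ j → root i ~ root j
  roots-adjacent {i} {j} i≢j with <-cmp (toℕ i) (toℕ j)
  ... | tri< i<j _ _ = inj₁ (root-root i<j)
  ... | tri≈ _ i≡j _ = contradiction (toℕ-injective i≡j) i≢j
  ... | tri> _ _ j<i = inj₂ (root-root j<i)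

  module LowerK (S : Subset N) (pvc : IsPVC G k S) where

    -- spine vertices in S, roots in S, roots outside S
    H : Subset k
    H = preimage (enc ∘ spine) S

    R : Subset a
    R = preimage (enc ∘ root) S

    F : Subset a
    F = ∁ R

    module Detour (H≤F : ∣ H ∣ ≤ ∣ F ∣) where

      substitute : ∀ {t} → t ∈ H → Fin a
      substitute t∈H = enum F (inject≤ (rank H t∈H) H≤F)

      pick : (t : Fin k) → Dec (t ∈ H) → V
      pick t (yes t∈H) = root (substitute t∈H)
      pick t (no _) = spine t

      pick-avoids : ∀ t d → enc (pick t d) ∉ S
      pick-avoids t (yes t∈H) ∈S = x∈∁p⇒x∉p (enum∈ F _) (∈-preimage⁺ (enc ∘ root) S ∈S)
      pick-avoids t (no t∉H) ∈S = t∉H (∈-preimage⁺ (enc ∘ spine) S ∈S)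

      pick-injective : ∀ t t′ d d′ → pick t d ≡ pick t′ d′ → t ≡ t′
      pick-injective t t′ (yes p) (yes p′) eq =
        rank-injective H p p′ (inject≤-injective _ _ _ _ (enum-injective F (root-injective eq)))
      pick-injective t t′ (no _) (no _) refl = refl
      pick-injective t t′ (yes _) (no _) ()
      pick-injective t t′ (no _) (yes _) ()

      pick-adjacent : ∀ t t′ d d′ → toℕ t′ ≡ suc (toℕ t) → pick t d ~ pick t′ d′
      pick-adjacent t t′ (yes p) (yes p′) e = roots-adjacent λ eq →
        1+n≢n (≡.trans (≡.sym e) (cong toℕ (≡.sym (pick-injective t t′ (yes p) (yes p′) (cong root eq)))))
      pick-adjacent t t′ (yes _) (no _) _ = inj₁ root-spine
      pick-adjacent t t′ (no _) (yes _) _ = inj₂ root-spine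
      pick-adjacent t t′ (no _) (no _) e = inj₁ (spine-step e)

      detour : Path G k
      detour = liftPath (λ t → pick t (t ∈? H))
        (λ {t} {t′} → pick-injective t t′ (t ∈? H) (t′ ∈? H))
        (λ t t′ → pick-adjacent t t′ (t ∈? H) (t′ ∈? H))

      impossible : ⊥
      impossible with pvc detour
      ... | t , t∈S = pick-avoids t (t ∈? H) t∈S

    frees<hits : ∣ F ∣ < ∣ H ∣
    frees<hits = ≰⇒> Detour.impossible

    roots+hits≤ : ∣ R ∣ + ∣ H ∣ ≤ ∣ S ∣
    roots+hits≤ = disjoint-injections⇒≤ S (enc ∘ root ∘ enum R) (enc ∘ spine ∘ enum H)
      (enum-injective R ∘ root-injective ∘ enc-injective)
      (enum-injective H ∘ spine-injective ∘ enc-injective)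
      (λ i j eq → root≢spine (enc-injective eq))
      (λ i → ∈-preimage⁻ (enc ∘ root) S (enum∈ R i))
      (λ j → ∈-preimage⁻ (enc ∘ spine) S (enum∈ H j))
      where
      root≢spine : ∀ {i t} → root i ≢ spine t
      root≢spine ()

    lowerK : suc a ≤ ∣ S ∣
    lowerK = begin
      suc a                       ≡⟨ cong suc (m+[n∸m]≡n (∣p∣≤n R)) ⟨
      suc (∣ R ∣ + (a ∸ ∣ R ∣))   ≡⟨ +-suc ∣ R ∣ _ ⟨
      ∣ R ∣ + suc (a ∸ ∣ R ∣)     ≡⟨ cong (λ f → ∣ R ∣ + suc f) (∣∁p∣≡n∸∣p∣ R) ⟨
      ∣ R ∣ + suc ∣ F ∣           ≤⟨ +-monoʳ-≤ ∣ R ∣ frees<hits ⟩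
      ∣ R ∣ + ∣ H ∣               ≤⟨ roots+hits≤ ⟩
      ∣ S ∣                       ∎
      where open ≤-Reasoning

  open LowerK using (lowerK)

  ψk : ψ≡ G k (suc a)
  ψk = s≤s z≤n , k≤N , (Sk , Sk-pvc , ≤-antisym Sk-size (lowerK Sk Sk-pvc)) , lowerK

  ψm : ψ≡ G m (a + (q + e))
  ψm = s≤s z≤n , ≤-trans (<⇒≤ m<k) k≤N , (Sm , Sm-pvc , ≤-antisym Sm-size (lowerM Sm Sm-pvc)) , lowerM

-- Main theorem: with pk = a + 1, q = k / m, r = k % m and e = pm ∸ (a + q) the construction
-- realises ψ_k = pk and ψ_m = a + q + e = pm; the hypothesis says exactly that e is not truncated.
mainTheorem1 : (k m : ℕ) → .{{_ : NonZero m}} → m < k →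
    (pk pm : ℕ) → 1 ≤ pk → pk + k / m ≤ pm + 1 →
    Σ Graph λ G → Nonempty G × Connected G × ψ≡ G k pk × ψ≡ G m pm
mainTheorem1 zero (suc m′) () pk pm _ _
mainTheorem1 (suc k′) (suc m′) m<k (suc a) pm _ pk+q≤pm+1 =
  G , nonempty , connected , ψk , subst (ψ≡ G (suc m′)) a+[q+e]≡pm ψm
  where
  q r e : ℕ
  q = suc k′ / suc m′
  r = suc k′ % suc m′
  e = pm ∸ (a + q)
  a+q≤pm : a + q ≤ pm
  a+q≤pm = s≤s⁻¹ (subst (suc a + q ≤_) (+-comm pm 1) pk+q≤pm+1)
  a+[q+e]≡pm : a + (q + e) ≡ pm
  a+[q+e]≡pm = ≡.trans (≡.sym (+-assoc a q e)) (m+[n∸m]≡n a+q≤pm)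
  open Construction a e q r m′ k′ (m≡m%n+[m/n]*n (suc k′) (suc m′)) (m%n<n (suc k′) (suc m′)) m<k
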